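{- Let $\mathcal{P}$ be a stable partition with a function $\mathsf{pred}_{\mathcal{P}}$ as described in the context, and let $\mathsf{pred}^{(b)}_{\mathcal{P}}$ denote its $b$-fold iterate ($\mathsf{pred}^{(0)}_{\mathcal{P}}(I)=I$). For any integer $I$ and any $b\ge1$, let $J=\mathsf{pred}^{(b)}_{\mathcal{P}}(I)$, $d=I-J$ and $I'=I+d$. Then $\mathsf{ed}(X[I..I'-1],Y[J..I-1])\le 4b\cdot\mathsf{sing}[J,I')$.
   Context: Setting: $L\ge1$, $X=Y$ is a string of length $L$ over $\Sigma$, and $E_0=\{(i_1,j_1),\dots,(i_M,j_M)\}\subseteq[L]^2$ with $i_t>j_t$, $X[i_t]=Y[j_t]$, $i_1<\dots<i_M$, $j_1<\dots<j_M$. Extend $X,Y$ to $\mathbb{Z}$ by $X[i]=Y[i]=X[L]$ for $i>L$ and $X[i]=Y[i]=X[1]$ for $i<1$; matched edges are $E=E_0\cup\{(i,i-1): i>L\text{ or } i\le1\}$ (non-intersecting, each edge $(I,J)$ has $I>J$). A segment $[l..r]$ is stable if for every $(I,J)\in E$ exactly one holds: ($J<l$ and $I\le r$) or ($J\ge l$ and $I>r$). A stable partition is a partition of $\mathbb{Z}$ into segments $\mathcal{P}_i=[p_i..p_{i+1}-1]$, $p_i<p_{i+1}$, each stable. $\mathsf{pred}_{\mathcal{P}}:\mathbb{Z}\to\mathbb{Z}$ is a non-decreasing function with $\mathsf{pred}_{\mathcal{P}}(p_{i+1})=p_i$ for all $i$ and, for all $I$, $\mathsf{pred}_{\mathcal{P}}(I)\le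 I-1$ and $[\mathsf{pred}_{\mathcal{P}}(I)..I-1]$ stable (such a function exists). A singleton is a position $i$ of $X$ with no edge $(i,\cdot)\in E$, or a position $j$ of $Y$ with no edge $(\cdot,j)\in E$; $\mathsf{sing}[l,r)$ is the total number of singletons of $X$ and of $Y$ among positions $l,\dots,r-1$. $\mathsf{ed}$ is edit distance. -}

module Defs where

open import Data.Nat as ℕ using (ℕ; zero; suc)
open import Data.Integer as ℤ using (ℤ; +_; -[1+_]; _-_; _<_; _≤_; _<?_; _≤?_; _≟_)
open import Data.Integer.Properties as ℤP using (+-assoc; +-inverseˡ; +-inverseʳ; +-identityʳ)
open import Data.Fin using (Fin; fromℕ<; fromℕ)
open import Data.Vec using (Vec; lookup)
open import Data.List using (List; []; _∷_; length)
open import Data.List.Membership.Propositional using (_∈_; find; lose)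
open import Data.List.Relation.Unary.Any using (Any; any?)
open import Data.List.Relation.Unary.All using (All)
open import Data.List.Relation.Unary.Linked using (Linked)
open import Data.Product using (Σ; ∃; _×_; _,_; proj₁; proj₂)
open import Data.Sum using (_⊎_; inj₁; inj₂)
open import Data.Empty using (⊥)
open import Relation.Nullary using (¬_; Dec; yes; no)
open import Relation.Nullary.Decidable using (_⊎-dec_)
open import Relation.Binary.Definitions using (DecidableEquality)
open import Relation.Binary.PropositionalEquality using (_≡_; refl; sym; trans; cong; subst)

1ℤ : ℤ
1ℤ = + 1

iter : {A : Set} → (A → A) → ℕ → A → A
iter f zero    x = x
iter f (suc b) x = f (iter f b x)

-- Strings of length L = suc n over Σ, extended to ℤ.
-- Position p ∈ {1..L} is stored at Vec index p-1.
-- X[i] = X[1] for i < 1, X[i] = X[L] for i > L.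

clampIdx : (n : ℕ) → ℤ → Fin (suc n)
clampIdx n -[1+ _ ]    = Fin.zero where import Data.Fin as Fin
clampIdx n (+ zero)    = Fin.zero where import Data.Fin as Fin
clampIdx n (+ suc k) with k ℕ.<? suc n
... | yes k<L = fromℕ< k<L
... | no  _   = fromℕ n

ext : {A : Set} {n : ℕ} → Vec A (suc n) → ℤ → A
ext {n = n} X i = lookup X (clampIdx n i)

Edge : ℕ → List (ℤ × ℤ) → ℤ → ℤ → Set
Edge L E₀ I J = ((I , J) ∈ E₀) ⊎ (((+ L < I) ⊎ (I ≤ + 1)) × (J ≡ I - + 1))

-- Hypotheses on E₀ ⊆ [L]² : i_t > j_t, X[i_t] = Y[j_t] (X = Y), and
-- i_1 < … < i_M, j_1 < … < j_M (E₀ listed in order).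
ValidE₀ : {A : Set} {n : ℕ} → Vec A (suc n) → List (ℤ × ℤ) → Set
ValidE₀ {n = n} X E₀ =
  All (λ e → (+ 1 ≤ proj₁ e) × (proj₁ e ≤ + suc n) × (+ 1 ≤ proj₂ e) × (proj₂ e ≤ + suc n)
             × (proj₂ e < proj₁ e) × (ext X (proj₁ e) ≡ ext X (proj₂ e))) E₀
  × Linked (λ e f → (proj₁ e < proj₁ f) × (proj₂ e < proj₂ f)) E₀

ExactlyOne : Set → Set → Set
ExactlyOne P Q = (P ⊎ Q) × ¬ (P × Q)

Stable : ℕ → List (ℤ × ℤ) → ℤ → ℤ → Set
Stable L E₀ l r = ∀ I J → Edge L E₀ I J →
  ExactlyOne ((J < l) × (I ≤ r)) ((l ≤ J) × (r < I))

StablePartition : ℕ → List (ℤ × ℤ) → (ℤ → ℤ) → Set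
StablePartition L E₀ p =
    (∀ i → p i < p (i ℤ.+ 1ℤ))
  × (∀ i → Stable L E₀ (p i) (p (i ℤ.+ 1ℤ) - 1ℤ))
  × (∀ x → ∃ λ i → (p i ≤ x) × (x < p (i ℤ.+ 1ℤ)))

IsPred : ℕ → List (ℤ × ℤ) → (ℤ → ℤ) → (ℤ → ℤ) → Set
IsPred L E₀ p pr =
    (∀ x y → x ≤ y → pr x ≤ pr y)
  × (∀ i → pr (p (i ℤ.+ 1ℤ)) ≡ p i)
  × (∀ I → (pr I ≤ I - 1ℤ) × Stable L E₀ (pr I) (I - 1ℤ))

XSingleton : ℕ → List (ℤ × ℤ) → ℤ → Set
XSingleton L E₀ i = ¬ (∃ λ J → Edge L E₀ i J)

YSingleton : ℕ → List (ℤ × ℤ) → ℤ → Set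
YSingleton L E₀ j = ¬ (∃ λ I → Edge L E₀ I j)

private
  k+1-1 : ∀ k → k ≡ (k ℤ.+ 1ℤ) - 1ℤ
  k+1-1 k = sym (trans (+-assoc k 1ℤ (ℤ.- 1ℤ)) (trans (cong (λ t → k ℤ.+ t) (+-inverseʳ 1ℤ)) (+-identityʳ k)))

  k-1+1 : ∀ k → (k - 1ℤ) ℤ.+ 1ℤ ≡ k
  k-1+1 k = trans (+-assoc k (ℤ.- 1ℤ) 1ℤ) (trans (cong (λ t → k ℤ.+ t) (+-inverseˡ 1ℤ)) (+-identityʳ k))

hasOut? : ∀ L E₀ i → Dec (∃ λ J → Edge L E₀ i J)
hasOut? L E₀ i with any? (λ e → proj₁ e ≟ i) E₀ | (+ L <? i) ⊎-dec (i ≤? + 1)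
... | yes a | _ with find a
...   | ((i' , j') , m , refl) = yes (j' , inj₁ m)
hasOut? L E₀ i | no _ | yes c = yes (i - 1ℤ , inj₂ (c , refl))
hasOut? L E₀ i | no ¬a | no ¬c = no λ where
  (J , inj₁ m)       → ¬a (lose m refl)
  (J , inj₂ (c , _)) → ¬c c

hasIn? : ∀ L E₀ j → Dec (∃ λ I → Edge L E₀ I j)
hasIn? L E₀ j with any? (λ e → proj₂ e ≟ j) E₀ | (+ L <? (j ℤ.+ 1ℤ)) ⊎-dec ((j ℤ.+ 1ℤ) ≤? + 1)
... | yes a | _ with find a
...   | ((i' , j') , m , refl) = yes (i' , inj₁ m)
hasIn? L E₀ j | no _ | yes c = yes (j ℤ.+ 1ℤ , inj₂ (c , k+1-1 j))
hasIn? L E₀ j | no ¬a | no ¬c = no λ where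
  (I , inj₁ m)        → ¬a (lose m refl)
  (I , inj₂ (c , eq)) → ¬c (subst (λ t → (+ L < t) ⊎ (t ≤ + 1))
                              (sym (trans (cong (λ t → t ℤ.+ 1ℤ) eq) (k-1+1 I))) c)

ind : {P : Set} → Dec P → ℕ
ind (yes _) = 0
ind (no  _) = 1

singAt : ℕ → List (ℤ × ℤ) → ℤ → ℕ
singAt L E₀ k = ind (hasOut? L E₀ k) ℕ.+ ind (hasIn? L E₀ k)

-- length of [l, r) (0 if r ≤ l)
width : ℤ → ℤ → ℕ
width l r with r - l
... | + m      = m
... | -[1+ _ ] = 0

sumFrom : (ℤ → ℕ) → ℤ → ℕ → ℕ
sumFrom f l zero    = 0
sumFrom f l (suc m) = f l ℕ.+ sumFrom f (l ℤ.+ 1ℤ) m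

sing : ℕ → List (ℤ × ℤ) → ℤ → ℤ → ℕ
sing L E₀ l r = sumFrom (singAt L E₀) l (width l r)

listFrom : {A : Set} → (ℤ → A) → ℤ → ℕ → List A
listFrom f l zero    = []
listFrom f l (suc m) = f l ∷ listFrom f (l ℤ.+ 1ℤ) m

substr : {A : Set} → (ℤ → A) → ℤ → ℤ → List A
substr f l r = listFrom f l (width l r)

min3 : ℕ → ℕ → ℕ → ℕ
min3 a b c = a ℕ.⊓ (b ℕ.⊓ c)

ed : {A : Set} → DecidableEquality A → List A → List A → ℕ
ed _≟A_ []       ys       = length ys
ed _≟A_ (x ∷ xs) []       = length (x ∷ xs)
ed _≟A_ (x ∷ xs) (y ∷ ys) =
  min3 (cost (x ≟A y) ℕ.+ ed _≟A_ xs ys)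
       (suc (ed _≟A_ xs (y ∷ ys)))
       (suc (ed _≟A_ (x ∷ xs) ys))
  where
    cost : {P : Set} → Dec P → ℕ
    cost (yes _) = 0
    cost (no  _) = 1

-- Put J₀ = I and J_{k+1} = pred(J_k), so that J = J_b and d = I - J.  Since [J_{k+1} .. J_k - 1]
-- is stable, no edge crosses the cut between position J_k of X and position J_{k+1} of Y.  From
-- such a cut, matching along edges and deleting (inserting) singletons of X (of Y) aligns
-- X[J_k .. J_k + d - 1] with Y[J_{k+1} .. J_{k+1} + d - 1] at cost at most twice the number of
-- singletons in these two windows, both of which lie in [J, I').  Since X = Y, these b alignments
-- compose, by the triangle inequality, to one of X[I .. I' - 1] with Y[J .. I - 1] of cost at most
-- 2b·sing[J, I').  Of the hypotheses on pred only pred(x) ≤ x - 1 and the stability of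
-- [pred(x) .. x - 1] are used.

module Submission where

open import Defs
open import Data.Nat as ℕ using (ℕ; zero; suc; z≤n; s≤s; ∣_-_∣)
import Data.Nat.Properties as ℕP
import Data.Nat.Tactic.RingSolver as ℕSolver
open import Data.Integer as ℤ using (ℤ; +_; -[1+_]; -1ℤ)
import Data.Integer.Properties as ℤP
import Data.Integer.Tactic.RingSolver as ℤSolver
open import Data.Fin as Fin using (fromℕ)
import Data.Fin.Properties as FinP
open import Data.Vec using (Vec; lookup)
open import Data.List using (List; []; _∷_; length)
open import Data.List.Membership.Propositional using (_∈_)
open import Data.List.Membership.Propositional.Properties using (∈-AllPairs₂)
import Data.List.Relation.Unary.All as All
open import Data.List.Relation.Unary.Linked.Properties using (Linked⇒AllPairs)
open import Data.Product using (∃; _×_; _,_; proj₁; proj₂)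
open import Data.Sum using (_⊎_; inj₁; inj₂)
open import Data.Empty using (⊥-elim)
open import Relation.Nullary using (¬_; Dec; yes; no)
open import Relation.Binary.Definitions using (DecidableEquality; tri<; tri≈; tri>)
open import Relation.Binary.PropositionalEquality
  using (_≡_; refl; sym; trans; cong; cong₂; subst; subst₂; module ≡-Reasoning)
open import Algebra.Properties.CommutativeSemigroup ℕP.+-commutativeSemigroup
  using () renaming (interchange to +-interchange)

module Alignments {A : Set} where
  open import Data.Nat using (_+_; _≤_)

  data Alignment : List A → List A → ℕ → Set where
    []     : Alignment [] [] 0
    del    : ∀ {x xs ys c} → Alignment xs ys c → Alignment (x ∷ xs) ys (suc c)
    ins    : ∀ {y xs ys c} → Alignment xs ys c → Alignment xs (y ∷ ys) (suc c)
    match  : ∀ {x y xs ys c} → x ≡ y → Alignment xs ys c → Alignment (x ∷ xs) (y ∷ ys) c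
    weaken : ∀ {xs ys c c′} → c ≤ c′ → Alignment xs ys c → Alignment xs ys c′

  Alignment-refl : ∀ xs → Alignment xs xs 0
  Alignment-refl []       = []
  Alignment-refl (x ∷ xs) = match refl (Alignment-refl xs)

  Alignment-trans : ∀ {xs ys zs c₁ c₂} →
                    Alignment xs ys c₁ → Alignment ys zs c₂ → Alignment xs zs (c₁ + c₂)
  Alignment-trans {c₂ = c₂} (weaken le s) t = weaken (ℕP.+-monoˡ-≤ c₂ le) (Alignment-trans s t)
  Alignment-trans {c₁ = c₁} s (weaken le t) = weaken (ℕP.+-monoʳ-≤ c₁ le) (Alignment-trans s t)
  Alignment-trans {c₁ = c₁} {suc c₂} s (ins t) =
    weaken (ℕP.≤-reflexive (sym (ℕP.+-suc c₁ c₂))) (ins (Alignment-trans s t))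
  Alignment-trans (del s) t = del (Alignment-trans s t)
  Alignment-trans [] [] = []
  Alignment-trans {c₁ = suc c₁} {suc c₂} (ins s) (del t) =
    weaken (ℕP.+-mono-≤ (ℕP.n≤1+n c₁) (ℕP.n≤1+n c₂)) (Alignment-trans s t)
  Alignment-trans (ins s) (match _ t) = ins (Alignment-trans s t)
  Alignment-trans {c₁ = c₁} {suc c₂} (match _ s) (del t) =
    weaken (ℕP.≤-reflexive (sym (ℕP.+-suc c₁ c₂))) (del (Alignment-trans s t))
  Alignment-trans (match e s) (match e′ t) = match (trans e e′) (Alignment-trans s t)

  ed≤cost : (_≟_ : DecidableEquality A) → ∀ {xs ys c} → Alignment xs ys c → ed _≟_ xs ys ≤ c
  ed≤cost _≟_ [] = z≤n
  ed≤cost _≟_ (del {xs = xs} {[]} s) = s≤s (subst (_≤ _) (ed-[] xs) (ed≤cost _≟_ s))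
    where
    ed-[] : ∀ xs → ed _≟_ xs [] ≡ length xs
    ed-[] []      = refl
    ed-[] (_ ∷ _) = refl
  ed≤cost _≟_ (del {ys = _ ∷ _} s) =
    ℕP.≤-trans (ℕP.m⊓n≤n _ _) (ℕP.≤-trans (ℕP.m⊓n≤m _ _) (s≤s (ed≤cost _≟_ s)))
  ed≤cost _≟_ (ins {xs = []} s) = s≤s (ed≤cost _≟_ s)
  ed≤cost _≟_ (ins {xs = _ ∷ _} s) =
    ℕP.≤-trans (ℕP.m⊓n≤n _ _) (ℕP.≤-trans (ℕP.m⊓n≤n _ _) (s≤s (ed≤cost _≟_ s)))
  ed≤cost _≟_ (match {x = x} refl s) with x ≟ x
  ... | yes _  = ℕP.≤-trans (ℕP.m⊓n≤m _ _) (ed≤cost _≟_ s)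
  ... | no x≢x = ⊥-elim (x≢x refl)
  ed≤cost _≟_ (weaken le s) = ℕP.≤-trans (ed≤cost _≟_ s) le

open Alignments

module IntegerSteps where
  open import Data.Integer using (_+_; _-_; _<_; _≤_)

  private
    i+1≡suc[i] : ∀ i → i + 1ℤ ≡ ℤ.suc i
    i+1≡suc[i] i = ℤP.+-comm i 1ℤ

    i-1≡pred[i] : ∀ i → i - 1ℤ ≡ ℤ.pred i
    i-1≡pred[i] i = ℤP.+-comm i -1ℤ

  i<i+1 : ∀ i → i < i + 1ℤ
  i<i+1 i = ℤP.suc[i]≤j⇒i<j (ℤP.≤-reflexive (sym (i+1≡suc[i] i)))

  i<j+1⇒i≤j : ∀ {i j} → i < j + 1ℤ → i ≤ j
  i<j+1⇒i≤j {i} {j} i<j+1 =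
    subst (i ≤_) (trans (cong ℤ.pred (i+1≡suc[i] j)) (ℤP.pred-suc j)) (ℤP.i<j⇒i≤pred[j] i<j+1)

  i≤j-1⇒i<j : ∀ {i j} → i ≤ j - 1ℤ → i < j
  i≤j-1⇒i<j {i} {j} i≤j-1 = ℤP.i≤pred[j]⇒i<j (subst (i ≤_) (i-1≡pred[i] j) i≤j-1)

  i<j⇒i≤j-1 : ∀ {i j} → i < j → i ≤ j - 1ℤ
  i<j⇒i≤j-1 {i} {j} i<j = subst (i ≤_) (sym (i-1≡pred[i] j)) (ℤP.i<j⇒i≤pred[j] i<j)

  i-1<j⇒i≤j : ∀ {i j} → i - 1ℤ < j → i ≤ j
  i-1<j⇒i≤j {i} {j} i-1<j =
    subst (_≤ j) (trans (cong ℤ.suc (i-1≡pred[i] i)) (ℤP.suc-pred i)) (ℤP.i<j⇒suc[i]≤j i-1<j)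

  ≤⇒<⊎≡ : ∀ {i j} → i ≤ j → i < j ⊎ i ≡ j
  ≤⇒<⊎≡ {i} {j} i≤j with i ℤ.≟ j
  ... | yes i≡j = inj₂ i≡j
  ... | no  i≢j = inj₁ (ℤP.≤∧≢⇒< i≤j i≢j)

  +-cancelˡ-≤ : ∀ i {j k} → i + j ≤ i + k → j ≤ k
  +-cancelˡ-≤ i {j} {k} i+j≤i+k = subst₂ _≤_ (cancel i j) (cancel i k) (ℤP.+-monoʳ-≤ (ℤ.- i) i+j≤i+k)
    where
    cancel : ∀ i j → ℤ.- i + (i + j) ≡ j
    cancel = ℤSolver.solve-∀

  i+[j-i]≡j : ∀ i j → i + (j - i) ≡ j
  i+[j-i]≡j = ℤSolver.solve-∀

  [i+j]-i≡j : ∀ i j → (i + j) - i ≡ j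
  [i+j]-i≡j = ℤSolver.solve-∀

  [i+[i-j]]-j≡[i-j]+[i-j] : ∀ i j → (i + (i - j)) - j ≡ (i - j) + (i - j)
  [i+[i-j]]-j≡[i-j]+[i-j] = ℤSolver.solve-∀

open IntegerSteps

module Sums where
  open import Data.Nat using (_+_; _≤_)

  sumFrom-+ : ∀ g l a w → sumFrom g l (a + w) ≡ sumFrom g l a + sumFrom g (l ℤ.+ + a) w
  sumFrom-+ g l zero    w = cong (λ i → sumFrom g i w) (sym (ℤP.+-identityʳ l))
  sumFrom-+ g l (suc a) w = begin
    g l + sumFrom g (l ℤ.+ 1ℤ) (a + w)
      ≡⟨ cong (λ s → g l + s) (sumFrom-+ g (l ℤ.+ 1ℤ) a w) ⟩
    g l + (sumFrom g (l ℤ.+ 1ℤ) a + sumFrom g (l ℤ.+ 1ℤ ℤ.+ + a) w)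
      ≡⟨ sym (ℕP.+-assoc (g l) _ _) ⟩
    g l + sumFrom g (l ℤ.+ 1ℤ) a + sumFrom g (l ℤ.+ 1ℤ ℤ.+ + a) w
      ≡⟨ cong (λ i → g l + sumFrom g (l ℤ.+ 1ℤ) a + sumFrom g i w) (ℤP.+-assoc l 1ℤ (+ a)) ⟩
    g l + sumFrom g (l ℤ.+ 1ℤ) a + sumFrom g (l ℤ.+ + suc a) w ∎
    where open ≡-Reasoning

  sumFrom-mono : ∀ g l {w w′} → w ≤ w′ → sumFrom g l w ≤ sumFrom g l w′
  sumFrom-mono g l {w} {w′} w≤w′ = begin
    sumFrom g l w                                       ≤⟨ ℕP.m≤m+n _ _ ⟩
    sumFrom g l w + sumFrom g (l ℤ.+ + w) (w′ ℕ.∸ w)   ≡⟨ sumFrom-+ g l w (w′ ℕ.∸ w) ⟨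
    sumFrom g l (w + (w′ ℕ.∸ w))                        ≡⟨ cong (sumFrom g l) (ℕP.m+[n∸m]≡n w≤w′) ⟩
    sumFrom g l w′                                      ∎
    where open ℕP.≤-Reasoning

  sumFrom-distrib : ∀ g h l w → sumFrom (λ i → g i + h i) l w ≡ sumFrom g l w + sumFrom h l w
  sumFrom-distrib g h l zero    = refl
  sumFrom-distrib g h l (suc w) = begin
    g l + h l + sumFrom (λ i → g i + h i) (l ℤ.+ 1ℤ) w
      ≡⟨ cong (λ s → g l + h l + s) (sumFrom-distrib g h (l ℤ.+ 1ℤ) w) ⟩
    g l + h l + (sumFrom g (l ℤ.+ 1ℤ) w + sumFrom h (l ℤ.+ 1ℤ) w)
      ≡⟨ +-interchange (g l) (h l) _ _ ⟩
    g l + sumFrom g (l ℤ.+ 1ℤ) w + (h l + sumFrom h (l ℤ.+ 1ℤ) w) ∎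
    where open ≡-Reasoning

  Subrange : ℤ → ℕ → ℤ → ℕ → Set
  Subrange x d l w = (l ℤ.≤ x) × (x ℤ.+ + d ℤ.≤ l ℤ.+ + w)

  subrange-double : ∀ {x l d} → l ℤ.≤ x → x ℤ.≤ l ℤ.+ + d → Subrange x d l (d + d)
  subrange-double {x} {l} {d} l≤x x≤l+d = l≤x , (begin
    x ℤ.+ + d           ≤⟨ ℤP.+-monoˡ-≤ (+ d) x≤l+d ⟩
    l ℤ.+ + d ℤ.+ + d   ≡⟨ ℤP.+-assoc l (+ d) (+ d) ⟩
    l ℤ.+ + (d + d)     ∎)
    where open ℤP.≤-Reasoning

  subrange-offset : ∀ {x d l w} → Subrange x d l w → ∃ λ a → (l ℤ.+ + a ≡ x) × (a + d ≤ w)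
  subrange-offset {x} {d} {l} {w} (l≤x , x+d≤l+w) =
    a , l+a≡x , ℤP.drop‿+≤+ (+-cancelˡ-≤ l (begin
      l ℤ.+ (+ a ℤ.+ + d) ≡⟨ ℤP.+-assoc l (+ a) (+ d) ⟨
      l ℤ.+ + a ℤ.+ + d   ≡⟨ cong (λ i → i ℤ.+ + d) l+a≡x ⟩
      x ℤ.+ + d           ≤⟨ x+d≤l+w ⟩
      l ℤ.+ + w           ∎))
    where
    open ℤP.≤-Reasoning
    a : ℕ
    a = ℤ.∣ x ℤ.- l ∣
    l+a≡x : l ℤ.+ + a ≡ x
    l+a≡x = trans (cong (λ i → l ℤ.+ i) (ℤP.0≤i⇒+∣i∣≡i (ℤP.i≤j⇒0≤j-i l≤x))) (i+[j-i]≡j l x)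

  sumFrom-subrange : ∀ g {x d l w} → Subrange x d l w → sumFrom g x d ≤ sumFrom g l w
  sumFrom-subrange g {d = d} {l} {w} sub with subrange-offset sub
  ... | a , refl , a+d≤w = begin
    sumFrom g (l ℤ.+ + a) d                 ≤⟨ ℕP.m≤n+m _ _ ⟩
    sumFrom g l a + sumFrom g (l ℤ.+ + a) d ≡⟨ sumFrom-+ g l a d ⟨
    sumFrom g l (a + d)                     ≤⟨ sumFrom-mono g l a+d≤w ⟩
    sumFrom g l w                           ∎
    where open ℕP.≤-Reasoning

  width-≡ : ∀ l r {m} → r ℤ.- l ≡ + m → width l r ≡ m
  width-≡ l r eq with r ℤ.- l
  width-≡ l r refl | .(+ _) = refl

open Sums

module Edges {Sym : Set} {n : ℕ} (X : Vec Sym (suc n)) {E₀ : List (ℤ × ℤ)} (valid : ValidE₀ X E₀) where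
  open import Data.Integer using (_+_; _-_; _<_; _≤_)

  _≺_ : ℤ × ℤ → ℤ × ℤ → Set
  e ≺ e′ = (proj₁ e < proj₁ e′) × (proj₂ e < proj₂ e′)

  ≺-trans : ∀ {e e′ e″} → e ≺ e′ → e′ ≺ e″ → e ≺ e″
  ≺-trans (i<i′ , j<j′) (i′<i″ , j′<j″) = ℤP.<-trans i<i′ i′<i″ , ℤP.<-trans j<j′ j′<j″

  clampIdx-≥ : ∀ {i} → + suc n ≤ i → clampIdx n i ≡ fromℕ n
  clampIdx-≥ {+ suc k} (ℤ.+≤+ (s≤s n≤k)) with k ℕ.<? suc n
  ... | yes k<1+n = FinP.toℕ-injective (begin
    Fin.toℕ (Fin.fromℕ< k<1+n) ≡⟨ FinP.toℕ-fromℕ< k<1+n ⟩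
    k                          ≡⟨ ℕP.≤-antisym (ℕP.≤-pred k<1+n) n≤k ⟩
    n                          ≡⟨ FinP.toℕ-fromℕ n ⟨
    Fin.toℕ (fromℕ n)          ∎)
    where open ≡-Reasoning
  ... | no _ = refl

  clampIdx-≤1 : ∀ {i} → i ≤ + 1 → clampIdx n i ≡ Fin.zero
  clampIdx-≤1 { -[1+ _ ]}    _ = refl
  clampIdx-≤1 {+ zero}       _ = refl
  clampIdx-≤1 {+ suc zero}   _ with 0 ℕ.<? suc n
  ... | yes _   = refl
  ... | no 0≮1+n = ⊥-elim (0≮1+n (s≤s z≤n))
  clampIdx-≤1 {+ suc (suc _)} (ℤ.+≤+ (s≤s ()))

  Edge′ : ℤ → ℤ → Set
  Edge′ = Edge (suc n) E₀

  private
    listed≶boundary : ∀ {I J I′} → (I , J) ∈ E₀ → (+ suc n < I′) ⊎ (I′ ≤ + 1) →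
                      (I , J) ≺ (I′ , I′ - 1ℤ) ⊎ (I′ , I′ - 1ℤ) ≺ (I , J)
    listed≶boundary I,J∈E₀ I′-outside with All.lookup (proj₁ valid) I,J∈E₀
    listed≶boundary {I} {J} {I′} _ (inj₁ L<I′) | _ , I≤L , _ , _ , J<I , _ =
      inj₁ (ℤP.≤-<-trans I≤L L<I′ , ℤP.<-≤-trans J<I (ℤP.≤-trans I≤L (i<j⇒i≤j-1 L<I′)))
    listed≶boundary {I} {J} {I′} _ (inj₂ I′≤1) | _ , _ , 1≤J , _ , J<I , _ =
      inj₂ (ℤP.≤-<-trans I′≤1 (ℤP.≤-<-trans 1≤J J<I) ,
            ℤP.<-≤-trans (i≤j-1⇒i<j ℤP.≤-refl) (ℤP.≤-trans I′≤1 1≤J))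

  edge-trichotomy : ∀ {I J I′ J′} → Edge′ I J → Edge′ I′ J′ →
                    (I , J) ≡ (I′ , J′) ⊎ (I , J) ≺ (I′ , J′) ⊎ (I′ , J′) ≺ (I , J)
  edge-trichotomy (inj₁ e∈E₀) (inj₁ e′∈E₀) =
    ∈-AllPairs₂ (Linked⇒AllPairs ≺-trans (proj₂ valid)) e∈E₀ e′∈E₀
  edge-trichotomy (inj₁ e∈E₀) (inj₂ (I′-outside , refl)) = inj₂ (listed≶boundary e∈E₀ I′-outside)
  edge-trichotomy (inj₂ (I-outside , refl)) (inj₁ e′∈E₀) with listed≶boundary e′∈E₀ I-outside
  ... | inj₁ e′≺e = inj₂ (inj₂ e′≺e)
  ... | inj₂ e≺e′ = inj₂ (inj₁ e≺e′)
  edge-trichotomy {I} {_} {I′} (inj₂ (_ , refl)) (inj₂ (_ , refl)) with ℤP.<-cmp I I′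
  ... | tri< I<I′ _ _ = inj₂ (inj₁ (I<I′ , ℤP.+-monoˡ-< -1ℤ I<I′))
  ... | tri≈ _ refl _ = inj₁ refl
  ... | tri> _ _ I′<I = inj₂ (inj₂ (I′<I , ℤP.+-monoˡ-< -1ℤ I′<I))

  edge-functional : ∀ {I J J′} → Edge′ I J → Edge′ I J′ → J ≡ J′
  edge-functional e e′ with edge-trichotomy e e′
  ... | inj₁ refl               = refl
  ... | inj₂ (inj₁ (I<I , _))   = ⊥-elim (ℤP.<-irrefl refl I<I)
  ... | inj₂ (inj₂ (I<I , _))   = ⊥-elim (ℤP.<-irrefl refl I<I)

  edge-injective : ∀ {I I′ J} → Edge′ I J → Edge′ I′ J → I ≡ I′
  edge-injective e e′ with edge-trichotomy e e′
  ... | inj₁ refl               = refl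
  ... | inj₂ (inj₁ (_ , J<J))   = ⊥-elim (ℤP.<-irrefl refl J<J)
  ... | inj₂ (inj₂ (_ , J<J))   = ⊥-elim (ℤP.<-irrefl refl J<J)

  edge-symbols : ∀ {I J} → Edge′ I J → ext X I ≡ ext X J
  edge-symbols (inj₁ e∈E₀) = proj₂ (proj₂ (proj₂ (proj₂ (proj₂ (All.lookup (proj₁ valid) e∈E₀)))))
  edge-symbols {I} (inj₂ (inj₁ L<I , refl)) = cong (lookup X) (begin
    clampIdx n I          ≡⟨ clampIdx-≥ (ℤP.<⇒≤ L<I) ⟩
    fromℕ n               ≡⟨ clampIdx-≥ (i<j⇒i≤j-1 L<I) ⟨
    clampIdx n (I - 1ℤ)   ∎)
    where open ≡-Reasoning
  edge-symbols {I} (inj₂ (inj₂ I≤1 , refl)) = cong (lookup X) (begin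
    clampIdx n I          ≡⟨ clampIdx-≤1 I≤1 ⟩
    Fin.zero              ≡⟨ clampIdx-≤1 (ℤP.≤-trans (ℤP.i-j≤i I (+ 1)) I≤1) ⟨
    clampIdx n (I - 1ℤ)   ∎)
    where open ≡-Reasoning

  Cut : ℤ → ℤ → Set
  Cut x y = ∀ {I J} → Edge′ I J → (J < y → I < x) × (I < x → J < y)

  stable⇒cut : ∀ {x y} → Stable (suc n) E₀ y (x - 1ℤ) → Cut x y
  stable⇒cut stable {I} {J} e with stable I J e
  ... | inj₁ (J<y , I≤x-1) , _ = (λ _ → i≤j-1⇒i<j I≤x-1) , (λ _ → J<y)
  ... | inj₂ (y≤J , x-1<I) , _ =
    (λ J<y → ⊥-elim (ℤP.≤⇒≯ y≤J J<y)) , (λ I<x → ⊥-elim (ℤP.≤⇒≯ (i-1<j⇒i≤j x-1<I) I<x))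

  cut-del : ∀ {x y} → Cut x y → ¬ ∃ (Edge′ x) → Cut (x + 1ℤ) y
  cut-del {x} cut no-edge e =
    (λ J<y → ℤP.<-trans (proj₁ (cut e) J<y) (i<i+1 x)) ,
    (λ I<x+1 → proj₂ (cut e) (ℤP.≤∧≢⇒< (i<j+1⇒i≤j I<x+1) λ { refl → no-edge (_ , e) }))

  cut-ins : ∀ {x y} → Cut x y → ¬ ∃ (λ I → Edge′ I y) → Cut x (y + 1ℤ)
  cut-ins {y = y} cut no-edge e =
    (λ J<y+1 → proj₁ (cut e) (ℤP.≤∧≢⇒< (i<j+1⇒i≤j J<y+1) λ { refl → no-edge (_ , e) })) ,
    (λ I<x → ℤP.<-trans (proj₂ (cut e) I<x) (i<i+1 y))

  cut-match : ∀ {x y} → Cut x y → Edge′ x y → Cut (x + 1ℤ) (y + 1ℤ)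
  cut-match {x} {y} cut x→y {I} {J} e = forward , backward
    where
    forward : J < y + 1ℤ → I < x + 1ℤ
    forward J<y+1 with ≤⇒<⊎≡ (i<j+1⇒i≤j J<y+1)
    ... | inj₁ J<y  = ℤP.<-trans (proj₁ (cut e) J<y) (i<i+1 x)
    ... | inj₂ refl = subst (_< x + 1ℤ) (edge-injective x→y e) (i<i+1 x)
    backward : I < x + 1ℤ → J < y + 1ℤ
    backward I<x+1 with ≤⇒<⊎≡ (i<j+1⇒i≤j I<x+1)
    ... | inj₁ I<x  = ℤP.<-trans (proj₂ (cut e) I<x) (i<i+1 y)
    ... | inj₂ refl = subst (_< y + 1ℤ) (edge-functional x→y e) (i<i+1 y)

  cut-edge : ∀ {x y J I} → Cut x y → Edge′ x J → Edge′ I y → Edge′ x y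
  cut-edge cut x→J I→y with edge-trichotomy x→J I→y
  ... | inj₁ refl             = x→J
  ... | inj₂ (inj₁ (_ , J<y)) = ⊥-elim (ℤP.<-irrefl refl (proj₁ (cut x→J) J<y))
  ... | inj₂ (inj₂ (I<x , _)) = ⊥-elim (ℤP.<-irrefl refl (proj₂ (cut I→y) I<x))

module Greedy {Sym : Set} {n : ℕ} (X : Vec Sym (suc n)) {E₀ : List (ℤ × ℤ)} (valid : ValidE₀ X E₀) where
  open import Data.Nat using (_+_; _*_; _≤_)
  open Edges X valid

  singX singY : ℤ → ℕ
  singX i = ind (hasOut? (suc n) E₀ i)
  singY j = ind (hasIn? (suc n) E₀ j)

  private
    indicator : ∀ {P : Set} (d : Dec P) → (¬ P × ind d ≡ 1) ⊎ (P × ind d ≡ 0)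
    indicator (yes p) = inj₂ (p , refl)
    indicator (no ¬p) = inj₁ (¬p , refl)

    ∣m-1+n∣≤1+∣m-n∣ : ∀ m n → ∣ m - suc n ∣ ≤ suc ∣ m - n ∣
    ∣m-1+n∣≤1+∣m-n∣ zero    n       = ℕP.≤-refl
    ∣m-1+n∣≤1+∣m-n∣ (suc m) zero    = ℕP.≤-trans (ℕP.≤-reflexive (ℕP.∣-∣-identityʳ m)) (ℕP.m≤n+m m 2)
    ∣m-1+n∣≤1+∣m-n∣ (suc m) (suc n) = ∣m-1+n∣≤1+∣m-n∣ m n

    ∣1+m-n∣≤1+∣m-n∣ : ∀ m n → ∣ suc m - n ∣ ≤ suc ∣ m - n ∣
    ∣1+m-n∣≤1+∣m-n∣ zero    zero    = ℕP.≤-refl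
    ∣1+m-n∣≤1+∣m-n∣ zero    (suc n) = ℕP.m≤n+m n 2
    ∣1+m-n∣≤1+∣m-n∣ (suc m) zero    = ℕP.≤-refl
    ∣1+m-n∣≤1+∣m-n∣ (suc m) (suc n) = ∣1+m-n∣≤1+∣m-n∣ m n

    charge-twice : ∀ {s s′ t u} → suc s ≡ s′ → t ≤ suc u → suc (2 * s + t) ≤ 2 * s′ + u
    charge-twice {s} {_} {t} {u} refl t≤1+u = begin
      suc (2 * s + t)     ≤⟨ s≤s (ℕP.+-monoʳ-≤ (2 * s) t≤1+u) ⟩
      suc (2 * s + suc u) ≡⟨ regroup s u ⟩
      2 * suc s + u       ∎
      where
      open ℕP.≤-Reasoning
      regroup : ∀ s u → suc (2 * s + suc u) ≡ 2 * suc s + u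
      regroup = ℕSolver.solve-∀

    insert-all : ∀ y k → Alignment [] (listFrom (ext X) y k) k
    insert-all y zero    = []
    insert-all y (suc k) = ins (insert-all (y ℤ.+ 1ℤ) k)

    delete-all : ∀ x m → Alignment (listFrom (ext X) x m) [] m
    delete-all x zero    = []
    delete-all x (suc m) = del (delete-all (x ℤ.+ 1ℤ) m)

  -- Every deletion or insertion is charged twice: once for itself and once for the
  -- growth of ∣ m - k ∣ it may cause.  Matched positions are never charged.
  greedy-alignment : ∀ m k {x y} → Cut x y →
    Alignment (listFrom (ext X) x m) (listFrom (ext X) y k)
              (2 * (sumFrom singX x m + sumFrom singY y k) + ∣ m - k ∣)
  greedy-alignment zero k {y = y} _ = weaken (ℕP.m≤n+m k _) (insert-all y k)
  greedy-alignment (suc m) zero {x} _ = weaken (ℕP.m≤n+m (suc m) _) (delete-all x (suc m))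
  greedy-alignment (suc m) (suc k) {x} {y} cut
    with indicator (hasOut? (suc n) E₀ x) | indicator (hasIn? (suc n) E₀ y)
  ... | inj₁ (no-out , singX≡1) | _ =
    weaken (charge-twice (cong (λ s → s + sX + sY) (sym singX≡1)) (∣m-1+n∣≤1+∣m-n∣ m k))
      (del (greedy-alignment m (suc k) (cut-del cut no-out)))
    where
    sX sY : ℕ
    sX = sumFrom singX (x ℤ.+ 1ℤ) m
    sY = sumFrom singY y (suc k)
  ... | inj₂ _ | inj₁ (no-in , singY≡1) =
    weaken (charge-twice (trans (sym (ℕP.+-suc sX sY)) (cong (λ s → sX + (s + sY)) (sym singY≡1)))
                         (∣1+m-n∣≤1+∣m-n∣ m k))
      (ins (greedy-alignment (suc m) k (cut-ins cut no-in)))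
    where
    sX sY : ℕ
    sX = sumFrom singX x (suc m)
    sY = sumFrom singY (y ℤ.+ 1ℤ) k
  ... | inj₂ ((_ , x→J) , singX≡0) | inj₂ ((_ , I→y) , singY≡0) =
    weaken (ℕP.≤-reflexive (cong₂ cost (sym singX≡0) (sym singY≡0)))
      (match (edge-symbols x→y) (greedy-alignment m k (cut-match cut x→y)))
    where
    x→y : Edge′ x y
    x→y = cut-edge cut x→J I→y
    cost : ℕ → ℕ → ℕ
    cost a b = 2 * (a + sumFrom singX (x ℤ.+ 1ℤ) m + (b + sumFrom singY (y ℤ.+ 1ℤ) k)) + ∣ m - k ∣

module Chain {Sym : Set} {n : ℕ} (X : Vec Sym (suc n)) {E₀ : List (ℤ × ℤ)} (valid : ValidE₀ X E₀)
             {pr : ℤ → ℤ} (pred-stable : ∀ x → (pr x ℤ.≤ x ℤ.- 1ℤ) × Stable (suc n) E₀ (pr x) (x ℤ.- 1ℤ))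
             where
  open import Data.Nat using (_+_; _*_; _≤_)
  open Edges X valid
  open Greedy X valid

  pred-alignment : ∀ x d →
    Alignment (listFrom (ext X) x d) (listFrom (ext X) (pr x) d)
              (2 * (sumFrom singX x d + sumFrom singY (pr x) d))
  pred-alignment x d =
    weaken (ℕP.≤-reflexive (trans (cong (λ t → c + t) (ℕP.∣n-n∣≡0 d)) (ℕP.+-identityʳ c)))
      (greedy-alignment d d (stable⇒cut (proj₂ (pred-stable x))))
    where
    c : ℕ
    c = 2 * (sumFrom singX x d + sumFrom singY (pr x) d)

  iter-antitone : ∀ x {k k′} → k ≤ k′ → iter pr k′ x ℤ.≤ iter pr k x
  iter-antitone x {k′ = zero}   z≤n = ℤP.≤-refl
  iter-antitone x {k′ = suc k′} k≤1+k′ with ℕP.m≤n⇒m<n∨m≡n k≤1+k′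
  ... | inj₁ k<1+k′ = ℤP.≤-trans (pr≤id (iter pr k′ x)) (iter-antitone x (ℕP.≤-pred k<1+k′))
    where
    pr≤id : ∀ x → pr x ℤ.≤ x
    pr≤id x = ℤP.<⇒≤ (i≤j-1⇒i<j (proj₁ (pred-stable x)))
  ... | inj₂ refl   = ℤP.≤-refl

  iter-alignment-within : ∀ {x d l w} k → (∀ i → i ≤ k → Subrange (iter pr i x) d l w) →
    Alignment (listFrom (ext X) x d) (listFrom (ext X) (iter pr k x) d)
              (k * (2 * sumFrom (singAt (suc n) E₀) l w))
  iter-alignment-within zero    _      = Alignment-refl _
  iter-alignment-within {x} {d} {l} {w} (suc k) inside =
    weaken (ℕP.≤-reflexive (ℕP.+-comm (k * (2 * S)) (2 * S)))
      (Alignment-trans (iter-alignment-within k (λ i i≤k → inside i (ℕP.m≤n⇒m≤1+n i≤k)))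
                       (weaken step-cost (pred-alignment (iter pr k x) d)))
    where
    S : ℕ
    S = sumFrom (singAt (suc n) E₀) l w
    step-cost : 2 * (sumFrom singX (iter pr k x) d + sumFrom singY (iter pr (suc k) x) d) ≤ 2 * S
    step-cost = ℕP.*-monoʳ-≤ 2 (begin
      sumFrom singX (iter pr k x) d + sumFrom singY (iter pr (suc k) x) d
        ≤⟨ ℕP.+-mono-≤ (sumFrom-subrange singX (inside k (ℕP.n≤1+n k)))
                       (sumFrom-subrange singY (inside (suc k) ℕP.≤-refl)) ⟩
      sumFrom singX l w + sumFrom singY l w
        ≡⟨ sumFrom-distrib singX singY l w ⟨
      S ∎)
      where open ℕP.≤-Reasoning

  iter-alignment : ∀ x b → let J = iter pr b x; d = ℤ.∣ x ℤ.- J ∣ in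
    Alignment (listFrom (ext X) x d) (listFrom (ext X) J d)
              (b * (2 * sumFrom (singAt (suc n) E₀) J (d + d)))
  iter-alignment x b = iter-alignment-within b λ i i≤b →
    subrange-double (iter-antitone x i≤b) (subst (iter pr i x ℤ.≤_) J+d≡x (iter-antitone x {k′ = i} z≤n))
    where
    J : ℤ
    J = iter pr b x
    J+d≡x : x ≡ J ℤ.+ + ℤ.∣ x ℤ.- J ∣
    J+d≡x = trans (sym (i+[j-i]≡j J x))
                  (cong (λ t → J ℤ.+ t) (sym (ℤP.0≤i⇒+∣i∣≡i (ℤP.i≤j⇒0≤j-i (iter-antitone x {k′ = b} z≤n)))))

open import Data.Nat using (_*_; _≤_)
open import Data.Integer using (_+_; _-_)

lemma4p15 : {Sym : Set} (_≟_ : DecidableEquality Sym) (n : ℕ) (X : Vec Sym (suc n))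
    (E₀ : List (ℤ × ℤ)) → ValidE₀ X E₀ →
    (p : ℤ → ℤ) → StablePartition (suc n) E₀ p →
    (pr : ℤ → ℤ) → IsPred (suc n) E₀ p pr →
    (I : ℤ) (b : ℕ) → 1 ≤ b →
    ed _≟_ (substr (ext X) I (I + (I - iter pr b I))) (substr (ext X) (iter pr b I) I)
      ≤ 4 * b * sing (suc n) E₀ (iter pr b I) (I + (I - iter pr b I))
lemma4p15 _≟_ n X E₀ valid _ _ pr (_ , _ , pred-stable) I b _ = begin
  ed _≟_ (substr (ext X) I (I + (I - J))) (substr (ext X) J I)
    ≡⟨ cong₂ (λ u v → ed _≟_ (listFrom (ext X) I u) (listFrom (ext X) J v))
             (width-≡ I (I + (I - J)) (trans ([i+j]-i≡j I (I - J)) I-J≡d))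
             (width-≡ J I I-J≡d) ⟩
  ed _≟_ (listFrom (ext X) I d) (listFrom (ext X) J d)
    ≤⟨ ed≤cost _≟_ (iter-alignment I b) ⟩
  b * (2 * S)
    ≤⟨ ℕP.m≤n*m (b * (2 * S)) 2 ⟩
  2 * (b * (2 * S))
    ≡⟨ regroup b S ⟩
  4 * b * S
    ≡⟨ cong (λ w → 4 * b * sumFrom (singAt (suc n) E₀) J w) (sym width-double) ⟩
  4 * b * sing (suc n) E₀ J (I + (I - J)) ∎
  where
  open ℕP.≤-Reasoning
  open Chain X valid pred-stable
  J : ℤ
  J = iter pr b I
  d : ℕ
  d = ℤ.∣ I - J ∣
  S : ℕ
  S = sumFrom (singAt (suc n) E₀) J (d ℕ.+ d)
  I-J≡d : I - J ≡ + d
  I-J≡d = sym (ℤP.0≤i⇒+∣i∣≡i (ℤP.i≤j⇒0≤j-i (iter-antitone I {k′ = b} z≤n)))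
  width-double : width J (I + (I - J)) ≡ d ℕ.+ d
  width-double = width-≡ J (I + (I - J)) (trans ([i+[i-j]]-j≡[i-j]+[i-j] I J) (cong₂ _+_ I-J≡d I-J≡d))
  regroup : ∀ b S → 2 * (b * (2 * S)) ≡ 4 * b * S
  regroup = ℕSolver.solve-∀
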